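{- Let $P$ be a finite poset, $\mathbb{K}$ a field of characteristic zero, $C\in\mathbb{K}$ a generic constant, and for $v\in P$ let $\tau_v:\mathbb{K}^P\dashrightarrow\mathbb{K}^P$ be the birational antichain toggle. Let $u,v\in P$. Then: (1) $\tau_v$ is an involution, i.e. $\tau_v\circ\tau_v$ is the identity (as a birational map); (2) if $u$ and $v$ are incomparable in $P$, then $\tau_u\circ\tau_v=\tau_v\circ\tau_u$.
   Context: $\mathbb{K}^P$ denotes the set of labelings $g:P\to\mathbb{K}$. For $v\in P$, let $\operatorname{MC}_v(P)$ be the set of maximal chains $(y_1,\dots,y_k)$ of $P$ containing $v$, and set $\Upsilon_v g=\sum_{(y_1,\dots,y_k)\in\operatorname{MC}_v(P)} g(y_1)\cdots g(y_k)$. The birational antichain toggle $\tau_v$ is defined by $(\tau_v g)(v)=C/\Upsilon_v g$ and $(\tau_v g)(x)=g(x)$ for $x\neq v$. Identities are meant as identities of birational maps (i.e., for generic labelings). -}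

module Defs where

open import Level using (Level; _⊔_) renaming (suc to lsuc)
open import Data.Nat using (ℕ; zero; suc)
open import Data.Fin using (Fin; _<_)
open import Data.Fin.Properties using (all?; any?)
import Data.Fin as F
open import Data.Vec.Functional using (_∷_)
open import Data.Product using (Σ; ∃; _×_; _,_)
open import Data.Sum using (_⊎_)
open import Relation.Nullary using (¬_; Dec; yes; no)
open import Relation.Nullary.Decidable using (_×-dec_; _⊎-dec_; _→-dec_; ¬?)
open import Relation.Binary.PropositionalEquality using (_≡_)
open import Relation.Binary.Structures using (IsDecPartialOrder)
open import Algebra.Bundles using (CommutativeRing)

record Field (c ℓ : Level) : Set (lsuc (c ⊔ ℓ)) where
  field
    commutativeRing : CommutativeRing c ℓ
  open CommutativeRing commutativeRing public
  field
    inv      : (x : Carrier) → ¬ (x ≈ 0#) → Carrier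
    inv-right : (x : Carrier) (p : ¬ (x ≈ 0#)) → (x * inv x p) ≈ 1#
    0≉1      : ¬ (0# ≈ 1#)

  fromℕ : ℕ → Carrier
  fromℕ zero    = 0#
  fromℕ (suc m) = 1# + fromℕ m

  CharZero : Set ℓ
  CharZero = (m : ℕ) → ¬ (fromℕ (suc m) ≈ 0#)

record FinPoset : Set₁ where
  field
    size  : ℕ
    _≤_   : Fin size → Fin size → Set
    isDecPartialOrder : IsDecPartialOrder _≡_ _≤_
  open IsDecPartialOrder isDecPartialOrder public
    using () renaming (_≟_ to _≟ₑ_; _≤?_ to _≤?_)

  Elem : Set
  Elem = Fin size

  _<ₚ_ : Elem → Elem → Set
  x <ₚ y = (x ≤ y) × ¬ (x ≡ y)

  _<ₚ?_ : (x y : Elem) → Dec (x <ₚ y)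
  x <ₚ? y = (x ≤? y) ×-dec ¬? (x ≟ₑ y)

  Comparable : Elem → Elem → Set
  Comparable x y = (x ≤ y) ⊎ (y ≤ x)

  Incomparable : Elem → Elem → Set
  Incomparable x y = ¬ Comparable x y

  Seq : ℕ → Set
  Seq k = Fin k → Elem

  IsChain : ∀ {k} → Seq k → Set
  IsChain {k} y = (i j : Fin k) → i < j → y i <ₚ y j

  IsMaximal : ∀ {k} → Seq k → Set
  IsMaximal {k} y = (z : Elem) → ((i : Fin k) → Comparable z (y i)) → ∃ λ i → y i ≡ z

  Contains : ∀ {k} → Seq k → Elem → Set
  Contains {k} y v = ∃ λ (i : Fin k) → y i ≡ v

  InMC : ∀ {k} → Elem → Seq k → Set
  InMC v y = (IsChain y × IsMaximal y) × Contains y v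

  InMC? : ∀ {k} (v : Elem) (y : Seq k) → Dec (InMC v y)
  InMC? {k} v y =
    ((all? λ i → all? λ j → (i F.<? j) →-dec (y i <ₚ? y j))
      ×-dec
     (all? λ z → (all? λ i → (z ≤? y i) ⊎-dec (y i ≤? z))
                   →-dec any? (λ i → y i ≟ₑ z)))
    ×-dec any? (λ i → y i ≟ₑ v)

module Toggle {c ℓ} (K : Field c ℓ) (P : FinPoset) where
  open Field K using (Carrier; _≈_; _+_; _*_; 0#; 1#; inv)
  open FinPoset P

  Labeling : Set c
  Labeling = Elem → Carrier

  sumFin : (m : ℕ) → (Fin m → Carrier) → Carrier
  sumFin zero    f = 0#
  sumFin (suc m) f = f F.zero + sumFin m (λ i → f (F.suc i))

  prodFin : (m : ℕ) → (Fin m → Carrier) → Carrier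
  prodFin zero    f = 1#
  prodFin (suc m) f = f F.zero * prodFin m (λ i → f (F.suc i))

  sumSeq : (k : ℕ) → (Seq k → Carrier) → Carrier
  sumSeq zero    G = G (λ ())
  sumSeq (suc k) G = sumFin size (λ a → sumSeq k (λ ys → G (a ∷ ys)))

  term : ∀ {k} → Elem → Labeling → Seq k → Carrier
  term {k} v g y with InMC? v y
  ... | yes _ = prodFin k (λ i → g (y i))
  ... | no  _ = 0#

  -- sum over lengths k = 0,…,|P| (a chain has at most |P| elements)
  sumLengths : (m : ℕ) → ((k : ℕ) → Carrier) → Carrier
  sumLengths zero    h = h zero
  sumLengths (suc m) h = h (suc m) + sumLengths m h

  Υ : Elem → Labeling → Carrier
  Υ v g = sumLengths size (λ k → sumSeq k (term v g))

  τ : (C : Carrier) (v : Elem) (g : Labeling) → ¬ (Υ v g ≈ 0#) → Labeling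
  τ C v g p x with x ≟ₑ v
  ... | yes _ = C * inv (Υ v g) p
  ... | no  _ = g x

module Submission where

-- Both statements reduce to two structural properties of
-- Υ_v g = Σ_{maximal chains y ∋ v} g(y₁)⋯g(y_k):
--   * locality: Υ_v g depends only on the labels of elements comparable
--     to v, since every element of a chain through v is comparable to v;
--   * homogeneity at v: if h agrees with g away from v, then
--     Υ_v h · g(v) = Υ_v g · h(v), since each chain through v contains v
--     exactly once, so every monomial is linear in the label at v.
-- (1) τ_v g agrees with g off v, so homogeneity gives
--     Υ_v(τ_v g) · g(v) = Υ_v g · C/Υ_v g = C, i.e. C/Υ_v(τ_v g) = g(v).
-- (2) If u ∥ v then v is not comparable to u, so by locality
--     Υ_u(τ_v g) = Υ_u g; hence τ_u(τ_v g)(u) = τ_u g(u), symmetrically at v,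
--     and elsewhere both composites leave g unchanged.

open import Defs
open import Level using (Level)
open import Data.Product using (_×_; _,_; proj₁; proj₂)
open import Relation.Nullary using (¬_; Dec; yes; no)
open import Data.Nat using (ℕ; zero; suc)
open import Data.Fin using (Fin)
import Data.Fin as F
open import Data.Fin.Properties using (<-cmp; suc-injective)
open import Data.Sum using (inj₁; inj₂)
open import Data.Empty using (⊥-elim)
open import Relation.Binary.Definitions using (tri<; tri≈; tri>)
import Relation.Binary.PropositionalEquality as ≡
open ≡ using (_≡_)
open import Relation.Binary.Structures using (IsDecPartialOrder)
import Relation.Binary.Reasoning.Setoid as SetoidReasoning

module ToggleTheory {c ℓ : Level} (K : Field c ℓ) (P : FinPoset) where
  open Field K hiding (zero)
  open FinPoset P
  open Toggle K P
  open SetoidReasoning setoid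

  prodFin-cong : ∀ m (f f′ : Fin m → Carrier) → (∀ j → f j ≈ f′ j) →
                 prodFin m f ≈ prodFin m f′
  prodFin-cong zero    f f′ e = refl
  prodFin-cong (suc m) f f′ e =
    *-cong (e F.zero) (prodFin-cong m _ _ (λ j → e (F.suc j)))

  *-swap-outer : ∀ a p b → (a * p) * b ≈ (b * p) * a
  *-swap-outer a p b = begin
    (a * p) * b ≈⟨ *-assoc a p b ⟩
    a * (p * b) ≈⟨ *-comm a (p * b) ⟩
    (p * b) * a ≈⟨ *-cong (*-comm p b) refl ⟩
    (b * p) * a ∎

  prodFin-exchange : ∀ m (f f′ : Fin m → Carrier) (i₀ : Fin m) →
    (∀ j → ¬ (j ≡ i₀) → f j ≈ f′ j) → prodFin m f * f′ i₀ ≈ prodFin m f′ * f i₀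
  prodFin-exchange (suc m) f f′ F.zero e = begin
    (f F.zero * prodFin m (λ i → f (F.suc i))) * f′ F.zero
      ≈⟨ *-cong (*-cong refl (prodFin-cong m _ _ (λ j → e (F.suc j) (λ ())))) refl ⟩
    (f F.zero * prodFin m (λ i → f′ (F.suc i))) * f′ F.zero
      ≈⟨ *-swap-outer _ _ _ ⟩
    (f′ F.zero * prodFin m (λ i → f′ (F.suc i))) * f F.zero ∎
  prodFin-exchange (suc m) f f′ (F.suc i₀) e = begin
    (f F.zero * prodFin m (λ i → f (F.suc i))) * f′ (F.suc i₀)
      ≈⟨ *-assoc _ _ _ ⟩
    f F.zero * (prodFin m (λ i → f (F.suc i)) * f′ (F.suc i₀))
      ≈⟨ *-cong (e F.zero (λ ())) (prodFin-exchange m _ _ i₀ e′) ⟩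
    f′ F.zero * (prodFin m (λ i → f′ (F.suc i)) * f (F.suc i₀))
      ≈⟨ sym (*-assoc _ _ _) ⟩
    (f′ F.zero * prodFin m (λ i → f′ (F.suc i))) * f (F.suc i₀) ∎
    where
    e′ : ∀ j → ¬ (j ≡ i₀) → f (F.suc j) ≈ f′ (F.suc j)
    e′ j j≢i₀ = e (F.suc j) (λ eq → j≢i₀ (suc-injective eq))

  sumFin-cross : ∀ m (f f′ : Fin m → Carrier) a b → (∀ i → f i * a ≈ f′ i * b) →
                 sumFin m f * a ≈ sumFin m f′ * b
  sumFin-cross zero    f f′ a b e = trans (zeroˡ a) (sym (zeroˡ b))
  sumFin-cross (suc m) f f′ a b e = begin
    (f F.zero + sumFin m (λ i → f (F.suc i))) * a
      ≈⟨ distribʳ a _ _ ⟩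
    f F.zero * a + sumFin m (λ i → f (F.suc i)) * a
      ≈⟨ +-cong (e F.zero) (sumFin-cross m _ _ a b (λ i → e (F.suc i))) ⟩
    f′ F.zero * b + sumFin m (λ i → f′ (F.suc i)) * b
      ≈⟨ sym (distribʳ b _ _) ⟩
    (f′ F.zero + sumFin m (λ i → f′ (F.suc i))) * b ∎

  sumSeq-cross : ∀ k (G G′ : Seq k → Carrier) a b → (∀ ys → G ys * a ≈ G′ ys * b) →
                 sumSeq k G * a ≈ sumSeq k G′ * b
  sumSeq-cross zero    G G′ a b e = e _
  sumSeq-cross (suc k) G G′ a b e =
    sumFin-cross size _ _ a b (λ x → sumSeq-cross k _ _ a b (λ ys → e _))

  sumLengths-cross : ∀ m (h h′ : ℕ → Carrier) a b → (∀ k → h k * a ≈ h′ k * b) →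
                     sumLengths m h * a ≈ sumLengths m h′ * b
  sumLengths-cross zero    h h′ a b e = e zero
  sumLengths-cross (suc m) h h′ a b e = begin
    (h (suc m) + sumLengths m h) * a
      ≈⟨ distribʳ a _ _ ⟩
    h (suc m) * a + sumLengths m h * a
      ≈⟨ +-cong (e (suc m)) (sumLengths-cross m h h′ a b e) ⟩
    h′ (suc m) * b + sumLengths m h′ * b
      ≈⟨ sym (distribʳ b _ _) ⟩
    (h′ (suc m) + sumLengths m h′) * b ∎

  inv-left : ∀ a (p : ¬ (a ≈ 0#)) → inv a p * a ≈ 1#
  inv-left a p = trans (*-comm _ _) (inv-right a p)

  inv-cong : ∀ a b (p : ¬ (a ≈ 0#)) (q : ¬ (b ≈ 0#)) → a ≈ b → inv a p ≈ inv b q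
  inv-cong a b p q a≈b = begin
    inv a p                 ≈⟨ sym (*-identityʳ _) ⟩
    inv a p * 1#            ≈⟨ *-cong refl (sym (inv-right b q)) ⟩
    inv a p * (b * inv b q) ≈⟨ sym (*-assoc _ _ _) ⟩
    (inv a p * b) * inv b q ≈⟨ *-cong (*-cong refl (sym a≈b)) refl ⟩
    (inv a p * a) * inv b q ≈⟨ *-cong (inv-left a p) refl ⟩
    1# * inv b q            ≈⟨ *-identityˡ _ ⟩
    inv b q                 ∎

  mul-div-cancel : ∀ y c (p : ¬ (y ≈ 0#)) → y * (c * inv y p) ≈ c
  mul-div-cancel y c p = begin
    y * (c * inv y p) ≈⟨ *-cong refl (*-comm _ _) ⟩
    y * (inv y p * c) ≈⟨ sym (*-assoc _ _ _) ⟩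
    (y * inv y p) * c ≈⟨ *-cong (inv-right y p) refl ⟩
    1# * c            ≈⟨ *-identityˡ _ ⟩
    c                 ∎

  div-solve : ∀ z x c (q : ¬ (z ≈ 0#)) → z * x ≈ c → c * inv z q ≈ x
  div-solve z x c q zx≈c = begin
    c * inv z q       ≈⟨ *-cong (sym zx≈c) refl ⟩
    (z * x) * inv z q ≈⟨ *-cong (*-comm _ _) refl ⟩
    (x * z) * inv z q ≈⟨ *-assoc _ _ _ ⟩
    x * (z * inv z q) ≈⟨ *-cong refl (inv-right z q) ⟩
    x * 1#            ≈⟨ *-identityʳ _ ⟩
    x                 ∎

  ≤-refl : ∀ {x} → x ≤ x
  ≤-refl = IsDecPartialOrder.refl isDecPartialOrder

  Comparable-sym : ∀ {x y} → Comparable x y → Comparable y x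
  Comparable-sym (inj₁ x≤y) = inj₂ x≤y
  Comparable-sym (inj₂ y≤x) = inj₁ y≤x

  chain-injective : ∀ {k} (y : Seq k) → IsChain y → ∀ i j → ¬ (i ≡ j) → ¬ (y i ≡ y j)
  chain-injective y ch i j i≢j with <-cmp i j
  ... | tri< i<j _ _ = proj₂ (ch i j i<j)
  ... | tri≈ _ i≡j _ = ⊥-elim (i≢j i≡j)
  ... | tri> _ _ j<i = λ eq → proj₂ (ch j i j<i) (≡.sym eq)

  chain-comparable : ∀ {k} (y : Seq k) → IsChain y → ∀ i j → Comparable (y i) (y j)
  chain-comparable y ch i j with <-cmp i j
  ... | tri< i<j _ _    = inj₁ (proj₁ (ch i j i<j))
  ... | tri≈ _ ≡.refl _ = inj₁ ≤-refl
  ... | tri> _ _ j<i    = inj₂ (proj₁ (ch j i j<i))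

  Υ-cross : ∀ v (g h : Labeling) a b →
    (∀ {k} (y : Seq k) → InMC v y →
       prodFin k (λ i → h (y i)) * a ≈ prodFin k (λ i → g (y i)) * b) →
    Υ v h * a ≈ Υ v g * b
  Υ-cross v g h a b e =
    sumLengths-cross size _ _ a b (λ k → sumSeq-cross k _ _ a b term-cross)
    where
    term-cross : ∀ {k} (y : Seq k) → term v h y * a ≈ term v g y * b
    term-cross y with InMC? v y
    ... | yes y∈MC = e y y∈MC
    ... | no  _    = trans (zeroˡ a) (sym (zeroˡ b))

  Υ-local : ∀ v (g h : Labeling) → (∀ x → Comparable v x → h x ≈ g x) → Υ v h ≈ Υ v g
  Υ-local v g h agree = begin
    Υ v h      ≈⟨ sym (*-identityʳ _) ⟩
    Υ v h * 1# ≈⟨ Υ-cross v g h 1# 1# monomial ⟩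
    Υ v g * 1# ≈⟨ *-identityʳ _ ⟩
    Υ v g      ∎
    where
    monomial : ∀ {k} (y : Seq k) → InMC v y →
      prodFin k (λ i → h (y i)) * 1# ≈ prodFin k (λ i → g (y i)) * 1#
    monomial {k} y ((ch , _) , (i₀ , yi₀≡v)) = *-cong (prodFin-cong k _ _ (λ j →
      agree (y j) (≡.subst (λ w → Comparable w (y j)) yi₀≡v (chain-comparable y ch i₀ j)))) refl

  -- Homogeneity at v: each chain through v contains v exactly once, so
  -- changing only the label at v rescales Υ_v accordingly.
  Υ-homogeneous : ∀ v (g h : Labeling) → (∀ x → ¬ (x ≡ v) → h x ≈ g x) →
                  Υ v h * g v ≈ Υ v g * h v
  Υ-homogeneous v g h agree = Υ-cross v g h (g v) (h v) monomial
    where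
    monomial : ∀ {k} (y : Seq k) → InMC v y →
      prodFin k (λ i → h (y i)) * g v ≈ prodFin k (λ i → g (y i)) * h v
    monomial {k} y ((ch , _) , (i₀ , ≡.refl)) =
      prodFin-exchange k (λ i → h (y i)) (λ i → g (y i)) i₀
        (λ j j≢i₀ → agree (y j) (chain-injective y ch j i₀ j≢i₀))

  τ-at : ∀ C v g p → τ C v g p v ≡ C * inv (Υ v g) p
  τ-at C v g p with v ≟ₑ v
  ... | yes _   = ≡.refl
  ... | no v≢v  = ⊥-elim (v≢v ≡.refl)

  τ-off : ∀ C v g p x → ¬ (x ≡ v) → τ C v g p x ≡ g x
  τ-off C v g p x x≢v with x ≟ₑ v
  ... | yes x≡v = ⊥-elim (x≢v x≡v)
  ... | no  _   = ≡.refl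

  -- Toggling at v leaves Υ_u unchanged when u and v are incomparable, so
  -- the value of τ_u at u is unaffected by a preceding τ_v.
  τ-at-after-incomparable : ∀ C u v → Incomparable u v → ∀ g p₁ q₁ p₂ →
    τ C u (τ C v g p₁) q₁ u ≈ τ C u g p₂ u
  τ-at-after-incomparable C u v u∥v g p₁ q₁ p₂ = begin
    τ C u (τ C v g p₁) q₁ u        ≡⟨ τ-at C u _ q₁ ⟩
    C * inv (Υ u (τ C v g p₁)) q₁  ≈⟨ *-cong refl (inv-cong _ _ q₁ p₂ Υ-unchanged) ⟩
    C * inv (Υ u g) p₂             ≡⟨ ≡.sym (τ-at C u g p₂) ⟩
    τ C u g p₂ u                   ∎
    where
    Υ-unchanged : Υ u (τ C v g p₁) ≈ Υ u g
    Υ-unchanged = Υ-local u g (τ C v g p₁) λ x u~x →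
      reflexive (τ-off C v g p₁ x λ { ≡.refl → u∥v u~x })

  τ-involutive : ∀ C v g p q x → τ C v (τ C v g p) q x ≈ g x
  τ-involutive C v g p q x = by-cases (x ≟ₑ v)
    where
    by-cases : Dec (x ≡ v) → τ C v (τ C v g p) q x ≈ g x
    by-cases (no x≢v)    = reflexive (≡.trans (τ-off C v _ q x x≢v) (τ-off C v g p x x≢v))
    by-cases (yes ≡.refl) = begin
      τ C v (τ C v g p) q v        ≡⟨ τ-at C v _ q ⟩
      C * inv (Υ v (τ C v g p)) q  ≈⟨ div-solve _ (g v) C q Υτ·g≈C ⟩
      g v                          ∎
      where
      Υτ·g≈C : Υ v (τ C v g p) * g v ≈ C
      Υτ·g≈C = begin
        Υ v (τ C v g p) * g v        ≈⟨ Υ-homogeneous v g _ τ-agrees-off-v ⟩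
        Υ v g * τ C v g p v          ≡⟨ ≡.cong (Υ v g *_) (τ-at C v g p) ⟩
        Υ v g * (C * inv (Υ v g) p)  ≈⟨ mul-div-cancel _ C p ⟩
        C                            ∎
        where
        τ-agrees-off-v : ∀ y → ¬ (y ≡ v) → τ C v g p y ≈ g y
        τ-agrees-off-v y y≢v = reflexive (τ-off C v g p y y≢v)

  τ-commute : ∀ C u v → Incomparable u v → ∀ g p₁ q₁ p₂ q₂ x →
    τ C u (τ C v g p₁) q₁ x ≈ τ C v (τ C u g p₂) q₂ x
  τ-commute C u v u∥v g p₁ q₁ p₂ q₂ x = by-cases (x ≟ₑ u) (x ≟ₑ v)
    where
    v∥u : Incomparable v u
    v∥u v~u = u∥v (Comparable-sym v~u)

    by-cases : Dec (x ≡ u) → Dec (x ≡ v) →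
               τ C u (τ C v g p₁) q₁ x ≈ τ C v (τ C u g p₂) q₂ x
    by-cases (yes ≡.refl) (yes ≡.refl) = ⊥-elim (u∥v (inj₁ ≤-refl))
    by-cases (yes ≡.refl) (no u≢v)    = begin
      τ C u (τ C v g p₁) q₁ u  ≈⟨ τ-at-after-incomparable C u v u∥v g p₁ q₁ p₂ ⟩
      τ C u g p₂ u             ≡⟨ ≡.sym (τ-off C v _ q₂ u u≢v) ⟩
      τ C v (τ C u g p₂) q₂ u  ∎
    by-cases (no v≢u)    (yes ≡.refl) = begin
      τ C u (τ C v g p₁) q₁ v  ≡⟨ τ-off C u _ q₁ v v≢u ⟩
      τ C v g p₁ v             ≈⟨ sym (τ-at-after-incomparable C v u v∥u g p₂ q₂ p₁) ⟩
      τ C v (τ C u g p₂) q₂ v  ∎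
    by-cases (no x≢u)    (no x≢v)    = begin
      τ C u (τ C v g p₁) q₁ x  ≡⟨ τ-off C u _ q₁ x x≢u ⟩
      τ C v g p₁ x             ≡⟨ τ-off C v g p₁ x x≢v ⟩
      g x                      ≡⟨ ≡.sym (τ-off C u g p₂ x x≢u) ⟩
      τ C u g p₂ x             ≡⟨ ≡.sym (τ-off C v _ q₂ x x≢v) ⟩
      τ C v (τ C u g p₂) q₂ x  ∎

proposition3p3 : ∀ {c ℓ : Level} (K : Field c ℓ) → Field.CharZero K →
  (P : FinPoset) → (C : Field.Carrier K) → (u v : FinPoset.Elem P) →
  let open Field K
      open FinPoset P using (Incomparable)
      open Toggle K P
  in
  -- (1) τ_v ∘ τ_v = id (wherever the composite is defined)
  ((g : Labeling) (p : ¬ (Υ v g ≈ 0#)) (q : ¬ (Υ v (τ C v g p) ≈ 0#)) →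
     ∀ x → τ C v (τ C v g p) q x ≈ g x)
  ×
  -- (2) u, v incomparable ⇒ τ_u ∘ τ_v = τ_v ∘ τ_u (wherever both are defined)
  (Incomparable u v →
    (g : Labeling)
    (p₁ : ¬ (Υ v g ≈ 0#)) (q₁ : ¬ (Υ u (τ C v g p₁) ≈ 0#))
    (p₂ : ¬ (Υ u g ≈ 0#)) (q₂ : ¬ (Υ v (τ C u g p₂) ≈ 0#)) →
    ∀ x → τ C u (τ C v g p₁) q₁ x ≈ τ C v (τ C u g p₂) q₂ x)
proposition3p3 K _ P C u v =
    τ-involutive C v
  , (λ u∥v → τ-commute C u v u∥v)
  where open ToggleTheory K P
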